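{- Let $X$ be a weakly connected finite digraph (no loops, no parallel arcs). If the $A$-Laplacian $L(X)$ is normal, then $X$ is eulerian, i.e. every vertex of $X$ has in-degree equal to its out-degree.
   Context: $A(X)$ is the adjacency matrix of $X$, $\Delta^+(X)$ is the diagonal matrix of out-degrees, and the $A$-Laplacian is $L(X)=\Delta^+(X)-A(X)$. A real matrix $M$ is normal if $MM^T=M^TM$. A weakly connected digraph is eulerian if in-degree equals out-degree at every vertex. -}

module Defs where

open import Data.Nat using (ℕ; zero; suc)
open import Data.Fin using (Fin; zero; suc; _≟_)
open import Data.Bool using (Bool; true; false; _∨_)
open import Data.Integer using (ℤ; +_; _+_; _*_; _-_; 0ℤ)
open import Data.Product using (Σ; _×_; ∃-syntax)
open import Relation.Binary.PropositionalEquality using (_≡_)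
open import Relation.Nullary using (¬_; yes; no)

-- A relation rather than a
-- multiset: no parallel arcs.
record Digraph (n : ℕ) : Set where
  field
    arc : Fin n → Fin n → Bool

open Digraph public

Loopless : ∀ {n} → Digraph n → Set
Loopless X = ∀ v → arc X v v ≡ false

∑ : ∀ n → (Fin n → ℤ) → ℤ
∑ zero    f = 0ℤ
∑ (suc n) f = f zero + ∑ n (λ i → f (suc i))

Matrix : ℕ → Set
Matrix n = Fin n → Fin n → ℤ

b2z : Bool → ℤ
b2z true  = + 1
b2z false = 0ℤ

A : ∀ {n} → Digraph n → Matrix n
A X i j = b2z (arc X i j)

outdeg : ∀ {n} → Digraph n → Fin n → ℤ
outdeg {n} X v = ∑ n (λ w → A X v w)

indeg : ∀ {n} → Digraph n → Fin n → ℤ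
indeg {n} X v = ∑ n (λ w → A X w v)

Δ⁺ : ∀ {n} → Digraph n → Matrix n
Δ⁺ X i j with i ≟ j
... | yes _ = outdeg X i
... | no  _ = 0ℤ

L : ∀ {n} → Digraph n → Matrix n
L X i j = Δ⁺ X i j - A X i j

transpose : ∀ {n} → Matrix n → Matrix n
transpose M i j = M j i

_⊗_ : ∀ {n} → Matrix n → Matrix n → Matrix n
_⊗_ {n} M N i j = ∑ n (λ k → M i k * N k j)

Normal : ∀ {n} → Matrix n → Set
Normal M = ∀ i j → (M ⊗ transpose M) i j ≡ (transpose M ⊗ M) i j

data UWalk {n} (X : Digraph n) : Fin n → Fin n → Set where
  here : ∀ {v} → UWalk X v v
  step : ∀ {u v w} → (arc X u v ∨ arc X v u) ≡ true → UWalk X v w → UWalk X u w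

WeaklyConnected : ∀ {n} → Digraph n → Set
WeaklyConnected X = ∀ u v → UWalk X u v

Eulerian : ∀ {n} → Digraph n → Set
Eulerian X = WeaklyConnected X × (∀ v → indeg X v ≡ outdeg X v)

module Submission where

-- Compare the diagonal entries of L Lᵀ and Lᵀ L at a vertex v:
--   (L Lᵀ) v v = Σₖ L(v,k)²   and   (Lᵀ L) v v = Σₖ L(k,v)².
-- For a loopless digraph every entry of L is either a diagonal entry
-- d⁺(v) (as A(v,v) = 0) or an off-diagonal entry -A(i,k) ∈ {0,-1}, whose
-- square is A(i,k) itself.  Hence
--   Σₖ L(v,k)² = d⁺(v)² + d⁺(v)   and   Σₖ L(k,v)² = d⁺(v)² + d⁻(v),
-- and normality of L, read on the diagonal, gives d⁺(v) = d⁻(v) after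
-- cancelling d⁺(v)².  Weak connectivity is a hypothesis and carries over.

open import Data.Nat using (ℕ; zero; suc)
open import Data.Fin using (Fin; zero; suc; _≟_)
open import Data.Fin.Properties using (suc-injective)
open import Data.Bool using (Bool; true; false)
open import Data.Integer using (ℤ; _+_; _*_; _-_; 0ℤ)
import Data.Integer.Properties as ℤ
open import Algebra.Bundles using (AbelianGroup)
open import Algebra.Properties.CommutativeSemigroup ℤ.+-commutativeSemigroup
  using (interchange)
open import Algebra.Properties.Group (AbelianGroup.group ℤ.+-0-abelianGroup)
  using (∙-cancelˡ)
open import Data.Product using (_,_)
open import Data.Empty using (⊥-elim)
open import Function using (_∘_)
open import Relation.Nullary using (¬_; yes; no)
open import Relation.Binary.PropositionalEquality
open import Defs

∑-cong : ∀ n {f g : Fin n → ℤ} → (∀ k → f k ≡ g k) → ∑ n f ≡ ∑ n g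
∑-cong zero    f≡g = refl
∑-cong (suc n) f≡g = cong₂ _+_ (f≡g zero) (∑-cong n (λ k → f≡g (suc k)))

∑-+ : ∀ n (f g : Fin n → ℤ) → ∑ n (λ k → f k + g k) ≡ ∑ n f + ∑ n g
∑-+ zero    f g = refl
∑-+ (suc n) f g = begin
  (f zero + g zero) + ∑ n (λ k → f (suc k) + g (suc k))
    ≡⟨ cong ((f zero + g zero) +_) (∑-+ n (λ k → f (suc k)) (λ k → g (suc k))) ⟩
  (f zero + g zero) + (∑ n (λ k → f (suc k)) + ∑ n (λ k → g (suc k)))
    ≡⟨ interchange (f zero) (g zero) _ _ ⟩
  (f zero + ∑ n (λ k → f (suc k))) + (g zero + ∑ n (λ k → g (suc k)))
    ∎
  where open ≡-Reasoning

∑-zero : ∀ n (f : Fin n → ℤ) → (∀ k → f k ≡ 0ℤ) → ∑ n f ≡ 0ℤ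
∑-zero zero    f f≡0 = refl
∑-zero (suc n) f f≡0 =
  cong₂ _+_ (f≡0 zero) (∑-zero n (λ k → f (suc k)) (λ k → f≡0 (suc k)))

∑-supported : ∀ n (i : Fin n) (f : Fin n → ℤ) →
              (∀ k → ¬ i ≡ k → f k ≡ 0ℤ) → ∑ n f ≡ f i
∑-supported (suc n) zero f off = begin
  f zero + ∑ n (λ k → f (suc k))
    ≡⟨ cong (f zero +_) (∑-zero n _ (λ k → off (suc k) (λ ()))) ⟩
  f zero + 0ℤ
    ≡⟨ ℤ.+-identityʳ (f zero) ⟩
  f zero
    ∎
  where open ≡-Reasoning
∑-supported (suc n) (suc i) f off = begin
  f zero + ∑ n (λ k → f (suc k))
    ≡⟨ cong₂ _+_ (off zero (λ ())) (∑-supported n i _ off-suc) ⟩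
  0ℤ + f (suc i)
    ≡⟨ ℤ.+-identityˡ (f (suc i)) ⟩
  f (suc i)
    ∎
  where
  open ≡-Reasoning
  off-suc : ∀ k → ¬ i ≡ k → f (suc k) ≡ 0ℤ
  off-suc k i≢k = off (suc k) (λ eq → i≢k (suc-injective eq))

negated-indicator-square : ∀ b → (0ℤ - b2z b) * (0ℤ - b2z b) ≡ b2z b
negated-indicator-square true  = refl
negated-indicator-square false = refl

module _ {n : ℕ} (X : Digraph n) where

  Δ⁺-diagonal : ∀ i → Δ⁺ X i i ≡ outdeg X i
  Δ⁺-diagonal i with i ≟ i
  ... | yes _   = refl
  ... | no  i≢i = ⊥-elim (i≢i refl)

  Δ⁺-off-diagonal : ∀ i k → ¬ i ≡ k → Δ⁺ X i k ≡ 0ℤ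
  Δ⁺-off-diagonal i k i≢k with i ≟ k
  ... | yes i≡k = ⊥-elim (i≢k i≡k)
  ... | no  _   = refl

  Δ⁺-row-sum : ∀ i (g : Fin n → ℤ) → ∑ n (λ k → Δ⁺ X i k * g k) ≡ outdeg X i * g i
  Δ⁺-row-sum i g = trans
    (∑-supported n i _ (λ k i≢k → cong (_* g k) (Δ⁺-off-diagonal i k i≢k)))
    (cong (_* g i) (Δ⁺-diagonal i))

  Δ⁺-column-sum : ∀ i (g : Fin n → ℤ) → ∑ n (λ k → Δ⁺ X k i * g k) ≡ outdeg X i * g i
  Δ⁺-column-sum i g = trans
    (∑-supported n i _ (λ k i≢k → cong (_* g k) (Δ⁺-off-diagonal k i (i≢k ∘ sym))))
    (cong (_* g i) (Δ⁺-diagonal i))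

  -- In a loopless digraph, L(i,k)² = Δ⁺(i,k) · d⁺(i) + A(i,k): on the
  -- diagonal it is d⁺(i)² (A(i,i) = 0), off it the square of -A(i,k).
  -- Splitting on i ≟ k also evaluates Δ⁺ X i k, which is defined by it.
  Laplacian-entry-square : Loopless X →
    ∀ i k → L X i k * L X i k ≡ Δ⁺ X i k * outdeg X i + A X i k
  Laplacian-entry-square loopless i k with i ≟ k
  ... | yes refl rewrite loopless i | ℤ.+-identityʳ (outdeg X i) =
    sym (ℤ.+-identityʳ _)
  ... | no  _    =
    trans (negated-indicator-square (arc X i k)) (sym (ℤ.+-identityˡ _))

  row-square-sum : Loopless X →
    ∀ v → ∑ n (λ k → L X v k * L X v k) ≡ outdeg X v * outdeg X v + outdeg X v
  row-square-sum loopless v = begin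
    ∑ n (λ k → L X v k * L X v k)
      ≡⟨ ∑-cong n (Laplacian-entry-square loopless v) ⟩
    ∑ n (λ k → Δ⁺ X v k * outdeg X v + A X v k)
      ≡⟨ ∑-+ n _ _ ⟩
    ∑ n (λ k → Δ⁺ X v k * outdeg X v) + outdeg X v
      ≡⟨ cong (_+ outdeg X v) (Δ⁺-row-sum v (λ _ → outdeg X v)) ⟩
    outdeg X v * outdeg X v + outdeg X v
      ∎
    where open ≡-Reasoning

  column-square-sum : Loopless X →
    ∀ v → ∑ n (λ k → L X k v * L X k v) ≡ outdeg X v * outdeg X v + indeg X v
  column-square-sum loopless v = begin
    ∑ n (λ k → L X k v * L X k v)
      ≡⟨ ∑-cong n (λ k → Laplacian-entry-square loopless k v) ⟩
    ∑ n (λ k → Δ⁺ X k v * outdeg X k + A X k v)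
      ≡⟨ ∑-+ n _ _ ⟩
    ∑ n (λ k → Δ⁺ X k v * outdeg X k) + indeg X v
      ≡⟨ cong (_+ indeg X v) (Δ⁺-column-sum v (outdeg X)) ⟩
    outdeg X v * outdeg X v + indeg X v
      ∎
    where open ≡-Reasoning

proposition2p2 : ∀ {n : ℕ} (X : Digraph n) → Loopless X → WeaklyConnected X →
    Normal (L X) → Eulerian X
proposition2p2 X loopless connected normal = connected , balanced
  where
  balanced : ∀ v → indeg X v ≡ outdeg X v
  balanced v = sym (∙-cancelˡ (outdeg X v * outdeg X v) _ _ (begin
    outdeg X v * outdeg X v + outdeg X v ≡⟨ sym (row-square-sum X loopless v) ⟩
    (L X ⊗ transpose (L X)) v v           ≡⟨ normal v v ⟩
    (transpose (L X) ⊗ L X) v v           ≡⟨ column-square-sum X loopless v ⟩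
    outdeg X v * outdeg X v + indeg X v   ∎))
    where open ≡-Reasoning
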